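{- Let $q\geq p \geq 1$ be integers. Then $$A_{p,q} = \sum_{j=0}^{p-1} \binom{q}{j}(1+x_1+\dots+x_p)^{q-j}\, \tilde{A}_{p,j}.$$ In particular, $A_{p,q}$ is divisible by $(1+x_1+\dots+x_p)^{q-p+1}$ in $\mathbb{Z}[x_1,\dots,x_p]$.
   Context: For integers $p\ge 1$, $k\ge 0$, let $K_{p,k}$ be the complete bipartite graph with vertex classes $V=\{v_1,\dots,v_p\}$ and $W=\{w_1,\dots,w_k\}$. A forest is a subset $F$ of the edge set containing no cycle; for a vertex $u$, $\deg_F(u)$ is the number of edges of $F$ incident to $u$. Define $$A_{p,k}=A_{p,k}(x_1,\dots,x_p) = \sum_{F} x_1^{\deg_F(v_1)} \cdots x_p^{\deg_F(v_p)},$$ summed over all forests $F$ of $K_{p,k}$, and $$\tilde{A}_{p,k}=\sum_{F} x_1^{\deg_F(v_1)} \cdots x_p^{\deg_F(v_p)},$$ summed over all forests $F$ of $K_{p,k}$ in which every vertex $w_i\in W$ has degree at least $2$ (so $\tilde A_{p,0}=1$). -}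

module Defs where

open import Level using (0ℓ)
open import Data.Bool using (Bool; true; false; if_then_else_)
open import Data.Nat using (ℕ; zero; suc; _≤_)
open import Data.Nat.Combinatorics using (_C_)
open import Data.Fin using (Fin; zero; suc; inject₁; fromℕ)
open import Data.List using (List; []; _∷_; map; concatMap; foldr)
open import Data.Product using (_×_; _,_)
open import Function.Definitions using (Injective)
open import Relation.Binary.PropositionalEquality using (_≡_)
open import Relation.Nullary using (¬_; Dec; does)
open import Algebra.Bundles using (CommutativeRing)

-- Edge sets of K_{p,k}: F v w = true iff the edge {v_v, w_w} is in F.

EdgeSet : ℕ → ℕ → Set
EdgeSet p k = Fin p → Fin k → Bool

-- A cycle in the (simple, bipartite) graph with edge set F:
-- a closed walk  a₀ b₀ a₁ b₁ … a_{m-1} b_{m-1} a₀  with m ≥ 2,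
-- pairwise distinct vertices a_i ∈ V, pairwise distinct vertices b_i ∈ W,
-- using only edges of F.  (Every cycle of a bipartite simple graph has this
-- form, of length 2m ≥ 4.)
record Cycle {p k : ℕ} (F : EdgeSet p k) : Set where
  field
    n      : ℕ                       -- m = n + 2
    a      : Fin (suc (suc n)) → Fin p
    b      : Fin (suc (suc n)) → Fin k
    a-inj  : Injective _≡_ _≡_ a
    b-inj  : Injective _≡_ _≡_ b
    edge₁  : ∀ i → F (a i) (b i) ≡ true
    edge₂  : ∀ (i : Fin (suc n)) → F (a (suc i)) (b (inject₁ i)) ≡ true
    edgeₑ  : F (a zero) (b (fromℕ (suc n))) ≡ true

IsForest : ∀ {p k} → EdgeSet p k → Set
IsForest F = ¬ Cycle F

-- A decision procedure for being a forest (needed to form the finite sums).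
ForestDec : Set
ForestDec = ∀ {p k} (F : EdgeSet p k) → Dec (IsForest F)

allFuns : ∀ {A : Set} (n : ℕ) → List A → List (Fin n → A)
allFuns zero    xs = (λ ()) ∷ []
allFuns (suc n) xs =
  concatMap (λ x → map (λ f → λ { zero → x ; (suc i) → f i }) (allFuns n xs)) xs

allEdgeSets : (p k : ℕ) → List (EdgeSet p k)
allEdgeSets p k = allFuns p (allFuns k (false ∷ true ∷ []))

filterB : ∀ {A : Set} → (A → Bool) → List A → List A
filterB P []       = []
filterB P (x ∷ xs) = if P x then x ∷ filterB P xs else filterB P xs

count : ∀ {n} → (Fin n → Bool) → ℕ
count {zero}  f = 0
count {suc n} f = (if f zero then 1 else 0) + count (λ i → f (suc i))
  where open Data.Nat using (_+_)

degV : ∀ {p k} → EdgeSet p k → Fin p → ℕ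
degV F v = count (F v)

degW : ∀ {p k} → EdgeSet p k → Fin k → ℕ
degW F w = count (λ v → F v w)

allB : ∀ {n} → (Fin n → Bool) → Bool
allB {zero}  f = true
allB {suc n} f = if f zero then allB (λ i → f (suc i)) else false

leqB : ℕ → ℕ → Bool
leqB zero    n       = true
leqB (suc m) zero    = false
leqB (suc m) (suc n) = leqB m n

data Poly (p : ℕ) : Set where
  var       : Fin p → Poly p
  0p 1p     : Poly p
  _⊕_ _⊗_   : Poly p → Poly p → Poly p
  ⊖_        : Poly p → Poly p

module InRing (R : CommutativeRing 0ℓ 0ℓ) where
  open CommutativeRing R using (Carrier; _+_; _*_; -_; 0#; 1#)

  Σ[_] : ∀ {n} → (Fin n → Carrier) → Carrier
  Σ[_] {zero}  f = 0#
  Σ[_] {suc n} f = f zero + Σ[ (λ i → f (suc i)) ]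

  Π[_] : ∀ {n} → (Fin n → Carrier) → Carrier
  Π[_] {zero}  f = 1#
  Π[_] {suc n} f = f zero * Π[ (λ i → f (suc i)) ]

  sumL : List Carrier → Carrier
  sumL = foldr _+_ 0#

  _^_ : Carrier → ℕ → Carrier
  x ^ zero  = 1#
  x ^ suc n = x * (x ^ n)

  fromℕ' : ℕ → Carrier
  fromℕ' zero    = 0#
  fromℕ' (suc n) = 1# + fromℕ' n

  ⟦_⟧ : ∀ {p} → Poly p → (Fin p → Carrier) → Carrier
  ⟦ var i ⟧ x = x i
  ⟦ 0p ⟧    x = 0#
  ⟦ 1p ⟧    x = 1#
  ⟦ P ⊕ Q ⟧ x = ⟦ P ⟧ x + ⟦ Q ⟧ x
  ⟦ P ⊗ Q ⟧ x = ⟦ P ⟧ x * ⟦ Q ⟧ x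
  ⟦ ⊖ P ⟧   x = - ⟦ P ⟧ x

  weight : ∀ {p k} → (Fin p → Carrier) → EdgeSet p k → Carrier
  weight x F = Π[ (λ v → x v ^ degV F v) ]

  A : ForestDec → (p k : ℕ) → (Fin p → Carrier) → Carrier
  A dec p k x = sumL (map (weight x) (filterB (λ F → does (dec F)) (allEdgeSets p k)))

  Ã : ForestDec → (p k : ℕ) → (Fin p → Carrier) → Carrier
  Ã dec p k x = sumL (map (weight x)
    (filterB (λ F → if does (dec F) then allB (λ w → leqB 2 (degW F w)) else false)
             (allEdgeSets p k)))

  S : ∀ {p} → (Fin p → Carrier) → Carrier
  S x = 1# + Σ[ x ]

{-# OPTIONS --safe #-}
-- Write S = 1 + x₁ + ⋯ + xₚ, and for a marking r of the W-vertices let forestSum r be the weighted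
-- sum over the forests of K_{p,k} in which every marked W-vertex has degree at least 2; so A_{p,k}
-- has no marks and Ã_{p,k} has all marks.  Split the forests according to the degree of an
-- unmarked vertex w: if it is at most 1, then w is isolated or a leaf at some vᵢ, and deleting it
-- leaves a forest, with weight factor 1 or xᵢ; otherwise w may as well be marked.  Hence
-- unmarking acts as S + E, where E shifts the number of marks, and the binomial theorem gives
-- A_{p,q} = Σⱼ C(q,j) S^{q-j} Ã_{p,j}, a sum that stops at j = p - 1 because Ã_{p,j} = 0 for
-- j ≥ p: replacing every W-vertex by an edge between two of its neighbours gives a loopless
-- multigraph with at least as many edges as vertices, and such a multigraph has a cycle
-- (delete vertices of degree ≤ 1; once all degrees are ≥ 2, walk without backtracking until a
-- vertex repeats).  Finally S^{q-j} = S^{q-p+1} S^{p-1-j} for j < p.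
module Submission where

open import Defs
open import Level using (0ℓ)
open import Data.Bool using (Bool; true; false; if_then_else_; _∧_; not)
open import Data.Empty using (⊥; ⊥-elim)
open import Data.Unit using (⊤)
open import Data.Fin as Fin using (Fin; zero; suc; toℕ; fromℕ; inject₁; punchIn; punchOut)
import Data.Fin.Properties as Fin
open import Data.Fin.Relation.Unary.Top using (view; ‵fromℕ; ‵inject₁)
open import Data.Nat using (ℕ; zero; suc; _≤_; _<_; _∸_; z≤n; s≤s; s≤s⁻¹)
import Data.Nat as ℕ
import Data.Nat.Properties as ℕ
open import Data.Nat.Combinatorics using (_C_; nCk+nC[k+1]≡[n+1]C[k+1])
open import Data.Nat.Combinatorics.Specification using (k>n⇒nCk≡0)
open import Data.List using (List; []; _∷_; map; concatMap; _++_)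
open import Data.Product using (∃; ∃₂; _×_; _,_; proj₁; proj₂)
open import Data.Sum using (_⊎_; inj₁; inj₂)
open import Data.Vec.Functional using (insertAt; removeAt) renaming (_∷_ to _◂_)
open import Data.Vec.Functional.Properties using (insertAt-lookup; insertAt-punchIn; insertAt-removeAt)
open import Function using (_∘_; id)
open import Function.Definitions using (Injective)
open import Relation.Binary.PropositionalEquality as ≡
  using (_≡_; _≢_; refl; cong; cong₂; subst; subst₂)
open import Relation.Nullary using (¬_; Dec; yes; no; does)
open import Relation.Nullary.Decidable using (does-⇔; ¬?; _×-dec_; _⊎-dec_)
open import Induction.WellFounded using (Acc; acc)
open import Relation.Binary.Definitions using (tri<; tri≈; tri>)
open import Data.Nat.Induction using (<-wellFounded)
open import Function.Bundles using (mk⇔)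
open import Algebra.Bundles using (CommutativeMonoid; CommutativeRing)
import Algebra.Properties.CommutativeSemigroup
import Data.Bool.Properties as Bool

private
  variable
    p k m : ℕ

  module ℕ+ = Algebra.Properties.CommutativeSemigroup ℕ.+-commutativeSemigroup
  module Bool∧ = Algebra.Properties.CommutativeSemigroup
    (CommutativeMonoid.commutativeSemigroup Bool.∧-commutativeMonoid)

⟨_⟩ : Bool → ℕ
⟨ b ⟩ = if b then 1 else 0

count-cong : {f g : Fin m → Bool} → (∀ i → f i ≡ g i) → count f ≡ count g
count-cong {zero}  f≗g = refl
count-cong {suc m} f≗g = cong₂ (λ b n → ⟨ b ⟩ ℕ.+ n) (f≗g zero) (count-cong (f≗g ∘ suc))

allB-cong : {f g : Fin m → Bool} → (∀ i → f i ≡ g i) → allB f ≡ allB g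
allB-cong {zero}  f≗g = refl
allB-cong {suc m} f≗g = cong₂ (λ b c → if b then c else false) (f≗g zero) (allB-cong (f≗g ∘ suc))

insertAt-cong : {A : Set} {f g : Fin m → A} → (∀ i → f i ≡ g i) →
                ∀ i x j → insertAt f i x j ≡ insertAt g i x j
insertAt-cong f≗g zero x zero = refl
insertAt-cong f≗g zero x (suc j) = f≗g j
insertAt-cong {suc m} f≗g (suc i) x zero = f≗g zero
insertAt-cong {suc m} f≗g (suc i) x (suc j) = insertAt-cong (f≗g ∘ suc) i x j

insertAt-map : {A B : Set} (g : A → B) (f : Fin m → A) → ∀ i x j →
               insertAt (g ∘ f) i (g x) j ≡ g (insertAt f i x j)
insertAt-map g f zero x zero = refl
insertAt-map g f zero x (suc j) = refl
insertAt-map {suc m} g f (suc i) x zero = refl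
insertAt-map {suc m} g f (suc i) x (suc j) = insertAt-map g (f ∘ suc) i x j

count-removeAt : (f : Fin (suc m) → Bool) (i : Fin (suc m)) →
                 count f ≡ ⟨ f i ⟩ ℕ.+ count (removeAt f i)
count-removeAt f zero = refl
count-removeAt {suc m} f (suc i) =
  ≡.trans (cong (⟨ f zero ⟩ ℕ.+_) (count-removeAt (f ∘ suc) i)) (ℕ+.x∙yz≈y∙xz ⟨ f zero ⟩ ⟨ f (suc i) ⟩ _)

count-insertAt : (f : Fin m → Bool) (i : Fin (suc m)) (b : Bool) →
                 count (insertAt f i b) ≡ ⟨ b ⟩ ℕ.+ count f
count-insertAt f i b = ≡.trans (count-removeAt (insertAt f i b) i)
  (cong₂ (λ b m → ⟨ b ⟩ ℕ.+ m) (insertAt-lookup f i b) (count-cong (insertAt-punchIn f i b)))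

count-true : (f : Fin (suc m) → Bool) {i : Fin (suc m)} → f i ≡ true →
             count f ≡ suc (count (removeAt f i))
count-true f {i} fᵢ = ≡.trans (count-removeAt f i) (cong (λ b → ⟨ b ⟩ ℕ.+ count (removeAt f i)) fᵢ)

count-const : ∀ m → count {m} (λ _ → true) ≡ m
count-const zero    = refl
count-const (suc m) = cong suc (count-const m)

count-false : ∀ m → count {m} (λ _ → false) ≡ 0
count-false zero    = refl
count-false (suc m) = count-false m

count≡0⇒all-false : (f : Fin m → Bool) → count f ≡ 0 → ∀ i → f i ≡ false
count≡0⇒all-false {suc m} f count≡0 i with f i in fᵢ
... | false = refl
... | true  with ≡.trans (≡.sym (count-true f fᵢ)) count≡0
...   | ()

allB-removeAt : (f : Fin (suc m) → Bool) (i : Fin (suc m)) →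
                allB f ≡ f i ∧ allB (removeAt f i)
allB-removeAt f zero with f zero
... | true  = refl
... | false = refl
allB-removeAt {suc m} f (suc i) = begin
  allB f                                              ≡⟨ allB-removeAt f zero ⟩
  f zero ∧ allB (f ∘ suc)                             ≡⟨ cong (f zero ∧_) (allB-removeAt (f ∘ suc) i) ⟩
  f zero ∧ (f (suc i) ∧ allB (removeAt (f ∘ suc) i))  ≡⟨ Bool∧.x∙yz≈y∙xz (f zero) (f (suc i)) _ ⟩
  f (suc i) ∧ (f zero ∧ allB (removeAt (f ∘ suc) i))
    ≡⟨ cong (f (suc i) ∧_) (≡.sym (allB-removeAt (removeAt f (suc i)) zero)) ⟩
  f (suc i) ∧ allB (removeAt f (suc i))               ∎
  where open ≡.≡-Reasoning

allB-true : allB {m} (λ _ → true) ≡ true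
allB-true {zero}  = refl
allB-true {suc m} = allB-true {m}

allB⇒all : (f : Fin m → Bool) → allB f ≡ true → ∀ i → f i ≡ true
allB⇒all {suc m} f all-f i with f zero in f₀
allB⇒all {suc m} f all-f zero    | true = f₀
allB⇒all {suc m} f all-f (suc i) | true = allB⇒all (f ∘ suc) all-f i

some-true : ∀ l (f : Fin m → Bool) → leqB (suc l) (count f) ≡ true → ∃ λ i → f i ≡ true
some-true {suc m} l f l<count with f zero in f₀
... | true  = zero , f₀
... | false = let i , fᵢ = some-true l (f ∘ suc) l<count in suc i , fᵢ

two-trues : (f : Fin m → Bool) → leqB 2 (count f) ≡ true →
            ∃₂ λ i j → i ≢ j × f i ≡ true × f j ≡ true
two-trues {suc m} f 2≤count =
  i , punchIn i j , Fin.punchInᵢ≢i i j ∘ ≡.sym , fᵢ , fⱼ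
  where
  i  = proj₁ (some-true 1 f 2≤count)
  fᵢ = proj₂ (some-true 1 f 2≤count)
  1≤rest : leqB 1 (count (removeAt f i)) ≡ true
  1≤rest = subst (λ c → leqB 2 c ≡ true) (count-true f fᵢ) 2≤count
  j  = proj₁ (some-true 0 (removeAt f i) 1≤rest)
  fⱼ = proj₂ (some-true 0 (removeAt f i) 1≤rest)

distinct-trues⇒2≤count : (f : Fin m → Bool) {i j : Fin m} → i ≢ j →
                         f i ≡ true → f j ≡ true → leqB 2 (count f) ≡ true
distinct-trues⇒2≤count {suc zero} f {zero} {zero} i≢j _ _ = ⊥-elim (i≢j refl)
distinct-trues⇒2≤count {suc (suc m)} f {i} {j} i≢j fᵢ fⱼ
  rewrite count-true f fᵢ
        | count-true (removeAt f i) {punchOut i≢j} (≡.trans (cong f (Fin.punchIn-punchOut i≢j)) fⱼ) = refl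

count<2⇒unique-true : (f : Fin m → Bool) → leqB 2 (count f) ≡ false →
                      ∀ {i j} → f i ≡ true → f j ≡ true → i ≡ j
count<2⇒unique-true f count<2 {i} {j} fᵢ fⱼ with i Fin.≟ j
... | yes i≡j = i≡j
... | no  i≢j with ≡.trans (≡.sym count<2) (distinct-trues⇒2≤count f i≢j fᵢ fⱼ)
...   | ()

filterB-none : {A : Set} (P : A → Bool) (xs : List A) → (∀ x → P x ≡ false) → filterB P xs ≡ []
filterB-none P []       none = refl
filterB-none P (x ∷ xs) none rewrite none x = filterB-none P xs none

_≗₂_ : EdgeSet p k → EdgeSet p k → Set
F ≗₂ G = ∀ v w → F v w ≡ G v w

insertColumn : Fin (suc k) → (Fin p → Bool) → EdgeSet p k → EdgeSet p (suc k)
insertColumn w c F v = insertAt (F v) w (c v)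

insertColumn-cong : ∀ w {c c′ : Fin p → Bool} {F G : EdgeSet p k} → (∀ v → c v ≡ c′ v) → F ≗₂ G →
                    insertColumn w c F ≗₂ insertColumn w c′ G
insertColumn-cong w {c′ = c′} {F} c≗c′ F≗G v w′ =
  ≡.trans (cong (λ b → insertAt (F v) w b w′) (c≗c′ v)) (insertAt-cong (F≗G v) w (c′ v) w′)

degW-insertColumn-at : ∀ w c (F : EdgeSet p k) → degW (insertColumn w c F) w ≡ count c
degW-insertColumn-at w c F = count-cong λ v → insertAt-lookup (F v) w (c v)

degW-insertColumn-punchIn : ∀ w c (F : EdgeSet p k) w′ → degW (insertColumn w c F) (punchIn w w′) ≡ degW F w′
degW-insertColumn-punchIn w c F w′ = count-cong λ v → insertAt-punchIn (F v) w (c v) w′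

requirement : Bool → ℕ → Bool
requirement r d = if r then leqB 2 d else true

Restricted : (Fin k → Bool) → EdgeSet p k → Bool
Restricted r F = allB (λ w → requirement (r w) (degW F w))

admissible : ForestDec → (Fin k → Bool) → EdgeSet p k → Bool
admissible dec r F = if does (dec F) then Restricted r F else false

Restricted-insertAt : ∀ (r : Fin k → Bool) w b c (F : EdgeSet p k) →
                      Restricted (insertAt r w b) (insertColumn w c F) ≡ requirement b (count c) ∧ Restricted r F
Restricted-insertAt r w b c F = ≡.trans
  (allB-removeAt (λ w′ → requirement (insertAt r w b w′) (degW (insertColumn w c F) w′)) w)
  (cong₂ _∧_ (cong₂ requirement (insertAt-lookup r w b) (degW-insertColumn-at w c F))
             (allB-cong λ w′ → cong₂ requirement (insertAt-punchIn r w b w′) (degW-insertColumn-punchIn w c F w′)))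

cycle-map : ∀ {k′} {F : EdgeSet p k} {G : EdgeSet p k′} (β : Fin k → Fin k′) → Injective _≡_ _≡_ β →
            (∀ {v w} → F v w ≡ true → G v (β w) ≡ true) → Cycle F → Cycle G
cycle-map β β-inj F⊆G γ = record
  { n = n ; a = a ; b = β ∘ b ; a-inj = a-inj ; b-inj = b-inj ∘ β-inj
  ; edge₁ = F⊆G ∘ edge₁ ; edge₂ = F⊆G ∘ edge₂ ; edgeₑ = F⊆G edgeₑ }
  where open Cycle γ

cycle-resp : {F G : EdgeSet p k} → F ≗₂ G → Cycle F → Cycle G
cycle-resp F≗G = cycle-map id id (λ {v} {w} e → ≡.trans (≡.sym (F≗G v w)) e)

does-forest-resp : (dec : ForestDec) {F G : EdgeSet p k} → F ≗₂ G → does (dec F) ≡ does (dec G)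
does-forest-resp dec F≗G = does-⇔
  (mk⇔ (λ forest → forest ∘ cycle-resp (λ v w → ≡.sym (F≗G v w))) (λ forest → forest ∘ cycle-resp F≗G))
  (dec _) (dec _)

cycle-insertColumn : ∀ w c {F : EdgeSet p k} → Cycle F → Cycle (insertColumn w c F)
cycle-insertColumn w c {F} = cycle-map (punchIn w) (Fin.punchIn-injective w _ _)
  (λ {v} {w′} e → ≡.trans (insertAt-punchIn (F v) w (c v) w′) e)

second-neighbour : {F : EdgeSet p k} (γ : Cycle F) (i : Fin (suc (suc (Cycle.n γ)))) →
                   ∃ λ j → j ≢ i × F (Cycle.a γ j) (Cycle.b γ i) ≡ true
second-neighbour γ i with view i
... | ‵fromℕ      = zero , (λ ()) , Cycle.edgeₑ γ
... | ‵inject₁ i′ = suc i′ , suc≢inject₁ , Cycle.edge₂ γ i′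
  where
  suc≢inject₁ : suc i′ ≢ inject₁ i′
  suc≢inject₁ eq = ℕ.1+n≢n (≡.trans (cong toℕ eq) (Fin.toℕ-inject₁ i′))

-- A W-vertex on a cycle has two distinct neighbours, so a column with fewer than two edges is avoided.
cycle-removeColumn : ∀ w c {F : EdgeSet p k} → leqB 2 (count c) ≡ false →
                     Cycle (insertColumn w c F) → Cycle F
cycle-removeColumn {k = k} w c {F} count<2 γ = record
  { n = n ; a = a ; b = b′ ; a-inj = a-inj
  ; b-inj = λ eq → b-inj (Fin.punchOut-injective (w≢b _) (w≢b _) eq)
  ; edge₁ = restrict ∘ edge₁ ; edge₂ = restrict ∘ edge₂ ; edgeₑ = restrict edgeₑ }
  where
  open Cycle γ
  on-column : ∀ {v} → insertColumn w c F v w ≡ true → c v ≡ true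
  on-column {v} = ≡.trans (≡.sym (insertAt-lookup (F v) w (c v)))
  w≢b : ∀ i → w ≢ b i
  w≢b i w≡b with second-neighbour γ i
  ... | j , j≢i , edge =
    j≢i (a-inj (count<2⇒unique-true c count<2
      (on-column (subst (λ w′ → insertColumn w c F (a j) w′ ≡ true) (≡.sym w≡b) edge))
      (on-column (subst (λ w′ → insertColumn w c F (a i) w′ ≡ true) (≡.sym w≡b) (edge₁ i)))))
  b′ : Fin (suc (suc n)) → Fin k
  b′ i = punchOut (w≢b i)
  restrict : ∀ {v i} → insertColumn w c F v (b i) ≡ true → F v (b′ i) ≡ true
  restrict {v} {i} e = ≡.trans (≡.sym (insertAt-punchIn (F v) w (c v) (b′ i)))
                             (≡.trans (cong (insertAt (F v) w (c v)) (Fin.punchIn-punchOut (w≢b i))) e)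

does-forest-insertColumn : (dec : ForestDec) → ∀ w c {F : EdgeSet p k} → leqB 2 (count c) ≡ false →
                           does (dec (insertColumn w c F)) ≡ does (dec F)
does-forest-insertColumn dec w c count<2 = does-⇔
  (mk⇔ (λ forest → forest ∘ cycle-insertColumn w c) (λ forest → forest ∘ cycle-removeColumn w c count<2))
  (dec _) (dec _)

-- Dense multigraphs contain cycles

injective-from-< : {A : Set} (f : ℕ → A) {T : ℕ} → (∀ {x y} → x < y → y < T → f x ≢ f y) →
                   ∀ {x y} → x < T → y < T → f x ≡ f y → x ≡ y
injective-from-< f distinct {x} {y} x<T y<T fx≡fy with ℕ.<-cmp x y
... | tri< x<y _ _ = ⊥-elim (distinct x<y y<T fx≡fy)
... | tri≈ _ x≡y _ = x≡y
... | tri> _ _ y<x = ⊥-elim (distinct y<x x<T (≡.sym fx≡fy))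

least : {P : ℕ → Set} → (∀ l → Dec (P l)) → ∀ {l} → P l → ∃ λ l₀ → P l₀ × (∀ {i} → i < l₀ → ¬ P i)
least {P} P? = go _ (<-wellFounded _)
  where
  go : ∀ l → Acc _<_ l → P l → ∃ λ l₀ → P l₀ × (∀ {i} → i < l₀ → ¬ P i)
  go l (acc smaller) Pl with ℕ.anyUpTo? P? l
  ... | yes (i , i<l , Pi) = go i (smaller i<l) Pi
  ... | no  none           = l , Pl , λ i<l Pi → none (_ , i<l , Pi)

module Multigraph {p j : ℕ} (s t : Fin j → Fin p) where

  Incident : Fin p → Fin j → Set
  Incident v e = s e ≡ v ⊎ t e ≡ v

  incident? : ∀ v e → Dec (Incident v e)
  incident? v e = s e Fin.≟ v ⊎-dec t e Fin.≟ v

  Loopless : Set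
  Loopless = ∀ e → s e ≢ t e

  Branching : Fin p → Set
  Branching v = ∃₂ λ e e′ → e ≢ e′ × Incident v e × Incident v e′

  branching? : ∀ v → Dec (Branching v)
  branching? v = Fin.any? λ e → Fin.any? λ e′ →
    ¬? (e Fin.≟ e′) ×-dec incident? v e ×-dec incident? v e′

  at-most-two-ends : ∀ {u₁ u₂ u₃ e} → Incident u₁ e → Incident u₂ e → Incident u₃ e →
                     u₁ ≢ u₂ → u₁ ≢ u₃ → u₂ ≢ u₃ → ⊥
  at-most-two-ends (inj₁ refl) (inj₁ refl) _           u₁≢u₂ _     _     = u₁≢u₂ refl
  at-most-two-ends (inj₂ refl) (inj₂ refl) _           u₁≢u₂ _     _     = u₁≢u₂ refl
  at-most-two-ends (inj₁ refl) (inj₂ refl) (inj₁ refl) _     u₁≢u₃ _     = u₁≢u₃ refl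
  at-most-two-ends (inj₁ refl) (inj₂ refl) (inj₂ refl) _     _     u₂≢u₃ = u₂≢u₃ refl
  at-most-two-ends (inj₂ refl) (inj₁ refl) (inj₁ refl) _     _     u₂≢u₃ = u₂≢u₃ refl
  at-most-two-ends (inj₂ refl) (inj₁ refl) (inj₂ refl) _     u₁≢u₃ _     = u₁≢u₃ refl

  record MultiCycle : Set where
    field
      n     : ℕ
      a     : Fin (suc (suc n)) → Fin p
      b     : Fin (suc (suc n)) → Fin j
      a-inj : Injective _≡_ _≡_ a
      b-inj : Injective _≡_ _≡_ b
      inc₁  : ∀ i → Incident (a i) (b i)
      inc₂  : ∀ (i : Fin (suc n)) → Incident (a (suc i)) (b (inject₁ i))
      incₑ  : Incident (a zero) (b (fromℕ (suc n)))

open Multigraph using (MultiCycle; branching?; incident?)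

multiCycle-map : ∀ {p j p′ j′} {s t : Fin j → Fin p} {s′ t′ : Fin j′ → Fin p′}
                 (α : Fin p′ → Fin p) (β : Fin j′ → Fin j) → Injective _≡_ _≡_ α → Injective _≡_ _≡_ β →
                 (∀ {u e} → Multigraph.Incident s′ t′ u e → Multigraph.Incident s t (α u) (β e)) →
                 MultiCycle s′ t′ → MultiCycle s t
multiCycle-map α β α-inj β-inj preserves γ = record
  { n = n ; a = α ∘ a ; b = β ∘ b ; a-inj = a-inj ∘ α-inj ; b-inj = b-inj ∘ β-inj
  ; inc₁ = preserves ∘ inc₁ ; inc₂ = preserves ∘ inc₂ ; incₑ = preserves incₑ }
  where open MultiCycle γ

multiCycle-restrict : ∀ {p j j′} {s t : Fin j → Fin p} (β : Fin j′ → Fin j) → Injective _≡_ _≡_ β →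
                      MultiCycle (s ∘ β) (t ∘ β) → MultiCycle s t
multiCycle-restrict β β-inj = multiCycle-map id β id β-inj id

module DeleteVertex {p j} (s t : Fin j → Fin (suc p)) (v : Fin (suc p))
                    (isolated : ∀ e → ¬ Multigraph.Incident s t v e) where
  open Multigraph s t using (Incident; Loopless)

  v≢s : ∀ e → v ≢ s e
  v≢s e eq = isolated e (inj₁ (≡.sym eq))

  v≢t : ∀ e → v ≢ t e
  v≢t e eq = isolated e (inj₂ (≡.sym eq))

  s′ t′ : Fin j → Fin p
  s′ e = punchOut (v≢s e)
  t′ e = punchOut (v≢t e)

  loopless′ : Loopless → Multigraph.Loopless s′ t′
  loopless′ loopless e eq = loopless e (Fin.punchOut-injective (v≢s e) (v≢t e) eq)

  lift : MultiCycle s′ t′ → MultiCycle s t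
  lift = multiCycle-map (punchIn v) id (Fin.punchIn-injective v _ _) id preserves
    where
    preserves : ∀ {u e} → Multigraph.Incident s′ t′ u e → Incident (punchIn v u) e
    preserves {e = e} (inj₁ refl) = inj₁ (≡.sym (Fin.punchIn-punchOut (v≢s e)))
    preserves {e = e} (inj₂ refl) = inj₂ (≡.sym (Fin.punchIn-punchOut (v≢t e)))

module NonBacktrackingWalk {p j} (s t : Fin j → Fin (suc p)) (loopless : Multigraph.Loopless s t)
                           (branching : ∀ v → Multigraph.Branching s t v) where
  open Multigraph s t using (Incident; at-most-two-ends)

  exit : Fin (suc p) → Fin j → Fin j
  exit v e with proj₁ (branching v) Fin.≟ e
  ... | yes _ = proj₁ (proj₂ (branching v))
  ... | no  _ = proj₁ (branching v)

  exit-≢ : ∀ v e → exit v e ≢ e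
  exit-≢ v e with proj₁ (branching v) Fin.≟ e
  ... | yes e₁≡e = λ e₂≡e → proj₁ (proj₂ (proj₂ (branching v))) (≡.trans e₁≡e (≡.sym e₂≡e))
  ... | no  e₁≢e = e₁≢e

  exit-incident : ∀ v e → Incident v (exit v e)
  exit-incident v e with proj₁ (branching v) Fin.≟ e
  ... | yes _ = proj₂ (proj₂ (proj₂ (proj₂ (branching v))))
  ... | no  _ = proj₁ (proj₂ (proj₂ (proj₂ (branching v))))

  across : Fin (suc p) → Fin j → Fin (suc p)
  across v e with s e Fin.≟ v
  ... | yes _ = t e
  ... | no  _ = s e

  across-incident : ∀ v e → Incident (across v e) e
  across-incident v e with s e Fin.≟ v
  ... | yes _ = inj₂ refl
  ... | no  _ = inj₁ refl

  across-≢ : ∀ {v e} → Incident v e → across v e ≢ v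
  across-≢ {v} {e} inc with s e Fin.≟ v
  across-≢ (inj₁ _)    | yes sₑ≡v = λ tₑ≡v → loopless _ (≡.trans sₑ≡v (≡.sym tₑ≡v))
  across-≢ (inj₂ tₑ≡v) | yes sₑ≡v = λ _ → loopless _ (≡.trans sₑ≡v (≡.sym tₑ≡v))
  ... | no sₑ≢v = sₑ≢v

  -- step m arrives at vertex V m along edge E m
  step : ℕ → Fin (suc p) × Fin j
  step zero    = zero , proj₁ (branching zero)
  step (suc m) = let v , e = step m in across v (exit v e) , exit v e

  V : ℕ → Fin (suc p)
  V = proj₁ ∘ step

  E : ℕ → Fin j
  E = proj₂ ∘ step

  arrival : ∀ m → Incident (V m) (E m)
  arrival zero    = proj₁ (proj₂ (proj₂ (proj₂ (branching zero))))
  arrival (suc m) = across-incident (V m) (E (suc m))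

  departure : ∀ m → Incident (V m) (E (suc m))
  departure m = exit-incident (V m) (E m)

  V-moves : ∀ m → V m ≢ V (suc m)
  V-moves m = across-≢ (departure m) ∘ ≡.sym

  repeats? : ∀ y → Dec (∃ λ x → x < y × V x ≡ V y)
  repeats? y = ℕ.anyUpTo? (λ x → V x Fin.≟ V y) y

  firstRepeat : ∃ λ T → (∃ λ S → S < T × V S ≡ V T) × (∀ {x y} → x < y → y < T → V x ≢ V y)
  firstRepeat with Fin.pigeonhole (ℕ.n<1+n (suc p)) (V ∘ toℕ)
  ... | i , i′ , i<i′ , Vi≡Vi′ with least repeats? (toℕ i , i<i′ , Vi≡Vi′)
  ...   | T , repeat , minimal = T , repeat , λ x<y y<T Vx≡Vy → minimal y<T (_ , x<y , Vx≡Vy)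

  E-injective-below : ∀ {T} → (∀ {x y} → x < y → y < T → V x ≢ V y) →
                      ∀ {x y} → x < y → y < T → E (suc x) ≢ E (suc y)
  E-injective-below injective-below {x} {y} x<y y<T Ex≡Ey with ℕ.m≤n⇒m<n∨m≡n x<y
  ... | inj₂ refl   = exit-≢ (V y) (E y) (≡.sym Ex≡Ey)
  ... | inj₁ 1+x<y = at-most-two-ends
    (departure x) (arrival (suc x)) (subst (Incident (V y)) (≡.sym Ex≡Ey) (departure y))
    (V-moves x) (injective-below x<y y<T) (injective-below 1+x<y y<T)

  closedSegment : ∀ S n → (∀ {x y} → x < y → y < suc (S ℕ.+ suc n) → V x ≢ V y) →
                  V S ≡ V (suc (S ℕ.+ suc n)) → MultiCycle s t
  closedSegment S n injective-below VS≡VT = record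
    { n     = n
    ; a     = λ i → V (S ℕ.+ toℕ i)
    ; b     = λ i → E (suc (S ℕ.+ toℕ i))
    ; a-inj = λ {i} {i′} → reindex i i′ ∘ injective-from-< V injective-below (bound i) (bound i′)
    ; b-inj = λ {i} {i′} → reindex i i′ ∘ injective-from-< (E ∘ suc)
                (E-injective-below injective-below) (bound i) (bound i′)
    ; inc₁  = λ i → departure (S ℕ.+ toℕ i)
    ; inc₂  = λ i → subst₂ Incident (cong V (≡.sym (ℕ.+-suc S (toℕ i))))
                (cong (λ m → E (suc (S ℕ.+ m))) (≡.sym (Fin.toℕ-inject₁ i))) (arrival (suc (S ℕ.+ toℕ i)))
    ; incₑ  = subst₂ Incident (≡.trans (≡.sym VS≡VT) (cong V (≡.sym (ℕ.+-identityʳ S))))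
                (cong (λ m → E (suc (S ℕ.+ m))) (≡.sym (Fin.toℕ-fromℕ (suc n)))) (arrival (suc (S ℕ.+ suc n)))
    }
    where
    bound : ∀ (i : Fin (suc (suc n))) → S ℕ.+ toℕ i < suc (S ℕ.+ suc n)
    bound i = s≤s (ℕ.+-monoʳ-≤ S (Fin.toℕ≤pred[n] i))
    reindex : ∀ (i i′ : Fin (suc (suc n))) → S ℕ.+ toℕ i ≡ S ℕ.+ toℕ i′ → i ≡ i′
    reindex i i′ = Fin.toℕ-injective ∘ ℕ.+-cancelˡ-≡ S _ _

  -- Up to the first repeated vertex the walk closes a cycle; its edges are distinct because
  -- consecutive edges differ and an edge has only two ends.
  cycle : MultiCycle s t
  cycle with firstRepeat
  ... | T , (S , S<T , VS≡VT) , injective-below with ℕ.m≤n⇒∃[o]m+o≡n S<T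
  ... | zero  , refl = ⊥-elim (V-moves S (≡.trans VS≡VT (cong V (ℕ.+-identityʳ (suc S)))))
  ... | suc n , refl = closedSegment S n injective-below VS≡VT

DenseCycles : ℕ → Set
DenseCycles p = ∀ {j} (s t : Fin j → Fin p) → Multigraph.Loopless s t → p ≤ j → 0 < j → MultiCycle s t

delete-isolated : DenseCycles p → ∀ {j} (s t : Fin j → Fin (suc p)) → Multigraph.Loopless s t →
                  p ≤ j → 0 < j → ∀ v → (∀ e → ¬ Multigraph.Incident s t v e) → MultiCycle s t
delete-isolated cycles s t loopless p≤j 0<j v isolated =
  lift (cycles s′ t′ (loopless′ loopless) p≤j 0<j)
  where open DeleteVertex s t v isolated

delete-leaf : DenseCycles p → ∀ {j} (s t : Fin (suc j) → Fin (suc p)) → Multigraph.Loopless s t →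
              p ≤ j → ∀ v e₀ → (∀ {e} → Multigraph.Incident s t v e → e ≡ e₀) → MultiCycle s t
delete-leaf {zero} cycles {zero} s t loopless _ v e₀ _ with s e₀ | t e₀ | loopless e₀
... | zero | zero | s≢t = ⊥-elim (s≢t refl)
delete-leaf {suc p} cycles {zero} s t loopless () v e₀ _
delete-leaf cycles {suc j} s t loopless p≤j v e₀ leaf =
  multiCycle-restrict (punchIn e₀) (Fin.punchIn-injective e₀ _ _)
    (delete-isolated cycles (s ∘ punchIn e₀) (t ∘ punchIn e₀) (loopless ∘ punchIn e₀) p≤j (s≤s z≤n) v
      (λ e inc → Fin.punchInᵢ≢i e₀ e (leaf inc)))

dense-multigraph-cycle : ∀ p → DenseCycles p
dense-multigraph-cycle zero    {suc j} s t _ _ _ with s zero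
... | ()
dense-multigraph-cycle (suc p) {suc j} s t loopless 1+p≤1+j 0<j with Fin.all? (branching? s t)
... | yes branching = NonBacktrackingWalk.cycle s t loopless branching
... | no ¬branching with Fin.¬∀⟶∃¬ _ _ (branching? s t) ¬branching
...   | v , ¬branching-v with Fin.any? (incident? s t v)
...     | no isolated = delete-isolated (dense-multigraph-cycle p) s t loopless
                          (ℕ.≤-trans (ℕ.n≤1+n p) 1+p≤1+j) 0<j v
                          (λ e inc → isolated (e , inc))
...     | yes (e₀ , inc₀) = delete-leaf (dense-multigraph-cycle p) s t loopless (s≤s⁻¹ 1+p≤1+j) v e₀ leaf
  where
  leaf : ∀ {e} → Multigraph.Incident s t v e → e ≡ e₀
  leaf {e} inc with e Fin.≟ e₀
  ... | yes e≡e₀ = e≡e₀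
  ... | no  e≢e₀ = ⊥-elim (¬branching-v (e , e₀ , e≢e₀ , inc , inc₀))

multiCycle⇒cycle : (F : EdgeSet p k) (s t : Fin k → Fin p) → (∀ w → F (s w) w ≡ true) →
                   (∀ w → F (t w) w ≡ true) → MultiCycle s t → Cycle F
multiCycle⇒cycle F s t F-s F-t γ = record
  { n = n ; a = a ; b = b ; a-inj = a-inj ; b-inj = b-inj
  ; edge₁ = edge ∘ inc₁ ; edge₂ = edge ∘ inc₂ ; edgeₑ = edge incₑ }
  where
  open MultiCycle γ
  edge : ∀ {v w} → Multigraph.Incident s t v w → F v w ≡ true
  edge {w = w} (inj₁ refl) = F-s w
  edge {w = w} (inj₂ refl) = F-t w

-- Each W-vertex is read as an edge between two of its neighbours.
W-degrees≥2⇒cycle : (F : EdgeSet p k) → 1 ≤ p → p ≤ k → (∀ w → leqB 2 (degW F w) ≡ true) → Cycle F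
W-degrees≥2⇒cycle F 1≤p p≤k deg≥2 =
  multiCycle⇒cycle F s t (proj₁ ∘ F-s,t) (proj₂ ∘ F-s,t)
    (dense-multigraph-cycle _ s t (λ w → proj₁ (proj₂ (proj₂ (neighbours w)))) p≤k (ℕ.≤-trans 1≤p p≤k))
  where
  neighbours : ∀ w → ∃₂ λ u v → u ≢ v × F u w ≡ true × F v w ≡ true
  neighbours w = two-trues (λ v → F v w) (deg≥2 w)
  s t : Fin _ → Fin _
  s w = proj₁ (neighbours w)
  t w = proj₁ (proj₂ (neighbours w))
  F-s,t : ∀ w → F (s w) w ≡ true × F (t w) w ≡ true
  F-s,t w = proj₂ (proj₂ (proj₂ (neighbours w)))

dense-admissible≡false : (dec : ForestDec) → 1 ≤ p → p ≤ k → (F : EdgeSet p k) →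
                         admissible dec (λ _ → true) F ≡ false
dense-admissible≡false dec 1≤p p≤k F with dec F
... | no  _      = refl
... | yes forest with allB (λ w → leqB 2 (degW F w)) in all≥2
...   | true  = ⊥-elim (forest (W-degrees≥2⇒cycle F 1≤p p≤k (allB⇒all _ all≥2)))
...   | false = refl

bits : List Bool
bits = false ∷ true ∷ []

module FiniteSums (R : CommutativeRing 0ℓ 0ℓ) where
  open CommutativeRing R hiding (zero) renaming (refl to ≈-refl)
  open InRing R
  open import Relation.Binary.Reasoning.Setoid setoid
  open Algebra.Properties.CommutativeSemigroup +-commutativeSemigroup using (interchange)
  open Algebra.Properties.CommutativeSemigroup *-commutativeSemigroup
    using () renaming (interchange to *-interchange)

  sumOver : {A : Set} → List A → (A → Carrier) → Carrier
  sumOver xs h = sumL (map h xs)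

  syntax sumOver xs (λ x → e) = ∑[ x ∈ xs ] e

  ∑-cong : {A : Set} (xs : List A) {g h : A → Carrier} → (∀ x → g x ≈ h x) →
           ∑[ x ∈ xs ] g x ≈ ∑[ x ∈ xs ] h x
  ∑-cong []       g≈h = ≈-refl
  ∑-cong (x ∷ xs) g≈h = +-cong (g≈h x) (∑-cong xs g≈h)

  ∑-++ : {A : Set} (xs ys : List A) (h : A → Carrier) →
         ∑[ x ∈ xs ++ ys ] h x ≈ ∑[ x ∈ xs ] h x + ∑[ y ∈ ys ] h y
  ∑-++ []       ys h = sym (+-identityˡ _)
  ∑-++ (x ∷ xs) ys h = trans (+-congˡ (∑-++ xs ys h)) (sym (+-assoc _ _ _))

  ∑-concatMap : {A B : Set} (xs : List A) (f : A → List B) (h : B → Carrier) →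
                ∑[ y ∈ concatMap f xs ] h y ≈ ∑[ x ∈ xs ] ∑[ y ∈ f x ] h y
  ∑-concatMap []       f h = ≈-refl
  ∑-concatMap (x ∷ xs) f h = trans (∑-++ (f x) (concatMap f xs) h) (+-congˡ (∑-concatMap xs f h))

  ∑-map : {A B : Set} (xs : List A) (f : A → B) (h : B → Carrier) →
          ∑[ y ∈ map f xs ] h y ≈ ∑[ x ∈ xs ] h (f x)
  ∑-map []       f h = ≈-refl
  ∑-map (x ∷ xs) f h = +-congˡ (∑-map xs f h)

  ∑-+ : {A : Set} (xs : List A) (g h : A → Carrier) →
        ∑[ x ∈ xs ] (g x + h x) ≈ ∑[ x ∈ xs ] g x + ∑[ x ∈ xs ] h x
  ∑-+ []       g h = sym (+-identityˡ 0#)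
  ∑-+ (x ∷ xs) g h = trans (+-congˡ (∑-+ xs g h)) (interchange _ _ _ _)

  ∑-*ˡ : {A : Set} (xs : List A) (c : Carrier) (h : A → Carrier) →
         ∑[ x ∈ xs ] (c * h x) ≈ c * ∑[ x ∈ xs ] h x
  ∑-*ˡ []       c h = sym (zeroʳ c)
  ∑-*ˡ (x ∷ xs) c h = trans (+-congˡ (∑-*ˡ xs c h)) (sym (distribˡ c _ _))

  ∑-*ʳ : {A : Set} (xs : List A) (c : Carrier) (h : A → Carrier) →
         ∑[ x ∈ xs ] (h x * c) ≈ ∑[ x ∈ xs ] h x * c
  ∑-*ʳ []       c h = sym (zeroˡ c)
  ∑-*ʳ (x ∷ xs) c h = trans (+-congˡ (∑-*ʳ xs c h)) (sym (distribʳ c _ _))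

  ∑-zero : {A : Set} (xs : List A) → ∑[ x ∈ xs ] 0# ≈ 0#
  ∑-zero []       = ≈-refl
  ∑-zero (x ∷ xs) = trans (+-identityˡ _) (∑-zero xs)

  ∑-comm : {A B : Set} (xs : List A) (ys : List B) (h : A → B → Carrier) →
           ∑[ x ∈ xs ] ∑[ y ∈ ys ] h x y ≈ ∑[ y ∈ ys ] ∑[ x ∈ xs ] h x y
  ∑-comm []       ys h = sym (∑-zero ys)
  ∑-comm (x ∷ xs) ys h = trans (+-congˡ (∑-comm xs ys h)) (sym (∑-+ ys (h x) _))

  ∑-filterB : {A : Set} (P : A → Bool) (xs : List A) (h : A → Carrier) →
              ∑[ x ∈ filterB P xs ] h x ≈ ∑[ x ∈ xs ] (if P x then h x else 0#)
  ∑-filterB P []       h = ≈-refl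
  ∑-filterB P (x ∷ xs) h with P x
  ... | true  = +-congˡ (∑-filterB P xs h)
  ... | false = trans (∑-filterB P xs h) (sym (+-identityˡ _))

  -- allFuns builds its functions by pattern lambdas, which agree with those built by _◂_ or
  -- insertAt only pointwise; hence the hypotheses Respects≗ below.
  Respects≗ : {A : Set} → ((Fin m → A) → Carrier) → Set
  Respects≗ h = ∀ {f g} → (∀ i → f i ≡ g i) → h f ≈ h g

  ∑-allFuns-suc : {A : Set} (xs : List A) (h : (Fin (suc m) → A) → Carrier) → Respects≗ h →
                  ∑[ f ∈ allFuns (suc m) xs ] h f ≈ ∑[ x ∈ xs ] ∑[ f ∈ allFuns m xs ] h (x ◂ f)
  ∑-allFuns-suc {m} xs h resp = begin
    ∑[ f ∈ allFuns (suc m) xs ] h f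
      ≈⟨ ∑-concatMap xs _ h ⟩
    ∑[ x ∈ xs ] ∑[ f ∈ map _ (allFuns m xs) ] h f
      ≈⟨ ∑-cong xs (λ x → trans (∑-map (allFuns m xs) _ h)
                                (∑-cong (allFuns m xs) λ f → resp λ { zero → refl ; (suc i) → refl })) ⟩
    ∑[ x ∈ xs ] ∑[ f ∈ allFuns m xs ] h (x ◂ f) ∎

  ∑-allFuns-insertAt : {A : Set} (xs : List A) (h : (Fin (suc m) → A) → Carrier) → Respects≗ h → ∀ w →
                       ∑[ f ∈ allFuns (suc m) xs ] h f ≈ ∑[ x ∈ xs ] ∑[ f ∈ allFuns m xs ] h (insertAt f w x)
  ∑-allFuns-insertAt {m} xs h resp zero =
    trans (∑-allFuns-suc xs h resp)
          (∑-cong xs λ x → ∑-cong (allFuns m xs) λ f → resp λ { zero → refl ; (suc i) → refl })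
  ∑-allFuns-insertAt {suc m} xs h resp (suc w) = begin
    ∑[ f ∈ allFuns (suc (suc m)) xs ] h f
      ≈⟨ ∑-allFuns-suc xs h resp ⟩
    ∑[ x ∈ xs ] ∑[ f ∈ allFuns (suc m) xs ] h (x ◂ f)
      ≈⟨ ∑-cong xs (λ x → ∑-allFuns-insertAt xs (h ∘ (x ◂_)) (λ f≗g → resp (◂-cong f≗g)) w) ⟩
    ∑[ x ∈ xs ] ∑[ y ∈ xs ] ∑[ f ∈ allFuns m xs ] h (x ◂ insertAt f w y)
      ≈⟨ ∑-comm xs xs _ ⟩
    ∑[ y ∈ xs ] ∑[ x ∈ xs ] ∑[ f ∈ allFuns m xs ] h (x ◂ insertAt f w y)
      ≈⟨ ∑-cong xs (λ y → ∑-cong xs λ x → ∑-cong (allFuns m xs) λ f →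
           resp λ { zero → refl ; (suc i) → refl }) ⟩
    ∑[ y ∈ xs ] ∑[ x ∈ xs ] ∑[ f ∈ allFuns m xs ] h (insertAt (x ◂ f) (suc w) y)
      ≈⟨ ∑-cong xs (λ y → sym (∑-allFuns-suc xs _ λ f≗g → resp (insertAt-cong f≗g (suc w) y))) ⟩
    ∑[ y ∈ xs ] ∑[ f ∈ allFuns (suc m) xs ] h (insertAt f (suc w) y) ∎
    where
    ◂-cong : ∀ {x} {f g : Fin (suc m) → _} → (∀ i → f i ≡ g i) → ∀ i → (x ◂ f) i ≡ (x ◂ g) i
    ◂-cong f≗g zero    = refl
    ◂-cong f≗g (suc i) = f≗g i

  Respects≗₂ : (EdgeSet p k → Carrier) → Set
  Respects≗₂ g = ∀ {F G} → F ≗₂ G → g F ≈ g G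

  -- Induction on rows: split the first row at w and move the sum over its entry at w outwards.
  ∑-allEdgeSets-insertColumn : (g : EdgeSet p (suc k) → Carrier) → Respects≗₂ g → ∀ w →
    ∑[ F ∈ allEdgeSets p (suc k) ] g F
      ≈ ∑[ c ∈ allFuns p bits ] ∑[ F ∈ allEdgeSets p k ] g (insertColumn w c F)
  ∑-allEdgeSets-insertColumn {zero} g resp w =
    +-cong (sym (trans (+-identityʳ _) (resp λ ()))) ≈-refl
  ∑-allEdgeSets-insertColumn {suc p} {k} g resp w = begin
    ∑[ F ∈ allEdgeSets (suc p) (suc k) ] g F
      ≈⟨ ∑-allFuns-suc (allFuns (suc k) bits) g (resp ∘ rows) ⟩
    ∑[ r ∈ allFuns (suc k) bits ] ∑[ F ∈ allEdgeSets p (suc k) ] g (r ◂ F)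
      ≈⟨ ∑-cong (allFuns (suc k) bits) (λ r → ∑-allEdgeSets-insertColumn (g ∘ (r ◂_)) (resp ∘ ◂-cong₂) w) ⟩
    ∑[ r ∈ allFuns (suc k) bits ] Φ r
      ≈⟨ ∑-allFuns-insertAt bits Φ Φ-resp w ⟩
    ∑[ b ∈ bits ] ∑[ r ∈ allFuns k bits ] Φ (insertAt r w b)
      ≈⟨ ∑-cong bits (λ b → ∑-comm (allFuns k bits) (allFuns p bits)
           λ r c → ∑[ F ∈ allEdgeSets p k ] g (insertAt r w b ◂ insertColumn w c F)) ⟩
    ∑[ b ∈ bits ] ∑[ c ∈ allFuns p bits ] ∑[ r ∈ allFuns k bits ] ∑[ F ∈ allEdgeSets p k ]
      g (insertAt r w b ◂ insertColumn w c F)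
      ≈⟨ ∑-cong bits (λ b → ∑-cong (allFuns p bits) λ c → ∑-cong (allFuns k bits) λ r →
           ∑-cong (allEdgeSets p k) λ F →
           resp {insertAt r w b ◂ insertColumn w c F} {insertColumn w (b ◂ c) (r ◂ F)}
             λ { zero w′ → refl ; (suc v) w′ → refl }) ⟩
    ∑[ b ∈ bits ] ∑[ c ∈ allFuns p bits ] ∑[ r ∈ allFuns k bits ] ∑[ F ∈ allEdgeSets p k ]
      g (insertColumn w (b ◂ c) (r ◂ F))
      ≈⟨ ∑-cong bits (λ b → ∑-cong (allFuns p bits) λ c → sym (∑-allFuns-suc (allFuns k bits)
           (λ F → g (insertColumn w (b ◂ c) F)) λ F≗G → resp (insertColumn-cong w (λ _ → refl) (rows F≗G)))) ⟩
    ∑[ b ∈ bits ] ∑[ c ∈ allFuns p bits ] ∑[ F ∈ allEdgeSets (suc p) k ] g (insertColumn w (b ◂ c) F)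
      ≈⟨ sym (∑-allFuns-suc bits (λ c → ∑[ F ∈ allEdgeSets (suc p) k ] g (insertColumn w c F))
           λ c≗c′ → ∑-cong (allEdgeSets (suc p) k) λ F →
           resp (insertColumn-cong w c≗c′ λ _ _ → refl)) ⟩
    ∑[ c ∈ allFuns (suc p) bits ] ∑[ F ∈ allEdgeSets (suc p) k ] g (insertColumn w c F) ∎
    where
    rows : ∀ {p k} {F G : EdgeSet p k} → (∀ v → F v ≡ G v) → F ≗₂ G
    rows F≗G v w = cong (λ r → r w) (F≗G v)
    ◂-cong₂ : ∀ {p k} {r : Fin k → Bool} {F G : EdgeSet p k} → F ≗₂ G → (r ◂ F) ≗₂ (r ◂ G)
    ◂-cong₂ F≗G zero    w = refl
    ◂-cong₂ F≗G (suc v) w = F≗G v w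
    Φ : (Fin (suc k) → Bool) → Carrier
    Φ r = ∑[ c ∈ allFuns p bits ] ∑[ F ∈ allEdgeSets p k ] g (r ◂ insertColumn w c F)
    Φ-resp : Respects≗ Φ
    Φ-resp r≗r′ = ∑-cong (allFuns p bits) λ c → ∑-cong (allEdgeSets p k) λ F →
      resp λ { zero w → r≗r′ w ; (suc v) w → refl }

  Σ-cong : {f g : Fin m → Carrier} → (∀ i → f i ≈ g i) → Σ[ f ] ≈ Σ[ g ]
  Σ-cong {zero}  f≈g = ≈-refl
  Σ-cong {suc m} f≈g = +-cong (f≈g zero) (Σ-cong (f≈g ∘ suc))

  Σ-+ : (f g : Fin m → Carrier) → Σ[ (λ i → f i + g i) ] ≈ Σ[ f ] + Σ[ g ]
  Σ-+ {zero}  f g = sym (+-identityˡ 0#)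
  Σ-+ {suc m} f g = trans (+-congˡ (Σ-+ (f ∘ suc) (g ∘ suc))) (interchange _ _ _ _)

  Σ-*ˡ : (c : Carrier) (f : Fin m → Carrier) → Σ[ (λ i → c * f i) ] ≈ c * Σ[ f ]
  Σ-*ˡ {zero}  c f = sym (zeroʳ c)
  Σ-*ˡ {suc m} c f = trans (+-congˡ (Σ-*ˡ c (f ∘ suc))) (sym (distribˡ c _ _))

  Σ-zero : {f : Fin m → Carrier} → (∀ i → f i ≈ 0#) → Σ[ f ] ≈ 0#
  Σ-zero {zero}  f≈0 = ≈-refl
  Σ-zero {suc m} f≈0 = trans (+-cong (f≈0 zero) (Σ-zero (f≈0 ∘ suc))) (+-identityˡ 0#)

  if-cong : ∀ {b b′ u u′ v v′} → b ≡ b′ → u ≈ u′ → v ≈ v′ →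
            (if b then u else v) ≈ (if b′ then u′ else v′)
  if-cong {true}  refl u≈u′ _    = u≈u′
  if-cong {false} refl _    v≈v′ = v≈v′

  Π-cong : {f g : Fin m → Carrier} → (∀ i → f i ≈ g i) → Π[ f ] ≈ Π[ g ]
  Π-cong {zero}  f≈g = ≈-refl
  Π-cong {suc m} f≈g = *-cong (f≈g zero) (Π-cong (f≈g ∘ suc))

  Π-* : (f g : Fin m → Carrier) → Π[ (λ i → f i * g i) ] ≈ Π[ f ] * Π[ g ]
  Π-* {zero}  f g = sym (*-identityˡ 1#)
  Π-* {suc m} f g = trans (*-congˡ (Π-* (f ∘ suc) (g ∘ suc))) (*-interchange _ _ _ _)

  fromℕ'-+ : ∀ m n → fromℕ' (m ℕ.+ n) ≈ fromℕ' m + fromℕ' n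
  fromℕ'-+ zero    n = sym (+-identityˡ _)
  fromℕ'-+ (suc m) n = trans (+-congˡ (fromℕ'-+ m n)) (sym (+-assoc _ _ _))

  ^-+ : ∀ y m n → y ^ (m ℕ.+ n) ≈ y ^ m * y ^ n
  ^-+ y zero    n = sym (*-identityˡ _)
  ^-+ y (suc m) n = trans (*-congˡ (^-+ y m n)) (sym (*-assoc _ _ _))

-- The binomial expansion

module Binomial (R : CommutativeRing 0ℓ 0ℓ) where
  open CommutativeRing R hiding (zero) renaming (refl to ≈-refl)
  open InRing R
  open FiniteSums R
  open import Relation.Binary.Reasoning.Setoid setoid
  open Algebra.Properties.CommutativeSemigroup +-commutativeSemigroup using (x∙yz≈xz∙y)
  open Algebra.Properties.CommutativeSemigroup *-commutativeSemigroup using (x∙yz≈y∙xz)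

  sumBelow : ℕ → (ℕ → Carrier) → Carrier
  sumBelow n g = Σ[ (λ (i : Fin n) → g (toℕ i)) ]

  sumBelow-truncate : ∀ {l n} (g : ℕ → Carrier) → l ≤ n → (∀ {j} → l ≤ j → g j ≈ 0#) →
                      sumBelow n g ≈ sumBelow l g
  sumBelow-truncate {zero} {n} g _       tail≈0 = Σ-zero {n} (λ _ → tail≈0 z≤n)
  sumBelow-truncate {suc l} g (s≤s l≤n) tail≈0 =
    +-congˡ (sumBelow-truncate (g ∘ suc) l≤n (λ l≤j → tail≈0 (s≤s l≤j)))

  -- shiftPow s a f t is ((s + E)ᶠ a)(t), where E is the shift (E a)(t) = a (t + 1).
  shiftPow : Carrier → (ℕ → Carrier) → ℕ → ℕ → Carrier
  shiftPow s a zero    t = a t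
  shiftPow s a (suc f) t = s * shiftPow s a f t + shiftPow s a f (suc t)

  binomialTerm : Carrier → (ℕ → Carrier) → ℕ → ℕ → ℕ → Carrier
  binomialTerm s a f t j = fromℕ' (f C j) * (s ^ (f ∸ j) * a (t ℕ.+ j))

  pull-factor : ∀ c s e A → c * (s ^ suc e * A) ≈ s * (c * (s ^ e * A))
  pull-factor c s e A = trans (*-congˡ (*-assoc s (s ^ e) A)) (x∙yz≈y∙xz c s _)

  pascal : ∀ s a f t j →
           binomialTerm s a (suc f) t (suc j) ≈ binomialTerm s a f (suc t) j + s * binomialTerm s a f t (suc j)
  pascal s a f t j = begin
    fromℕ' (suc f C suc j) * Y
      ≡⟨ cong (λ n → fromℕ' n * Y) (≡.sym (nCk+nC[k+1]≡[n+1]C[k+1] f j)) ⟩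
    fromℕ' (f C j ℕ.+ f C suc j) * Y
      ≈⟨ trans (*-congʳ (fromℕ'-+ (f C j) _)) (distribʳ Y _ _) ⟩
    fromℕ' (f C j) * Y + fromℕ' (f C suc j) * Y
      ≈⟨ +-cong (reflexive (cong (λ m → fromℕ' (f C j) * (s ^ (f ∸ j) * a m)) (ℕ.+-suc t j))) upper ⟩
    binomialTerm s a f (suc t) j + s * binomialTerm s a f t (suc j) ∎
    where
    Y = s ^ (f ∸ j) * a (t ℕ.+ suc j)
    upper : fromℕ' (f C suc j) * Y ≈ s * binomialTerm s a f t (suc j)
    upper with j ℕ.<? f
    ... | yes j<f rewrite ℕ.+-∸-assoc 1 j<f = pull-factor _ s (f ∸ suc j) _
    ... | no  j≮f rewrite k>n⇒nCk≡0 (s≤s (ℕ.≮⇒≥ j≮f)) =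
      trans (zeroˡ Y) (sym (trans (*-congˡ (zeroˡ _)) (zeroʳ s)))

  shiftPow-binomial : ∀ s a f t {N} → f < N → shiftPow s a f t ≈ sumBelow N (binomialTerm s a f t)
  shiftPow-binomial s a zero t {suc N} _ = sym (begin
    (1# + 0#) * (1# * a (t ℕ.+ 0)) + sumBelow N (binomialTerm s a 0 t ∘ suc)
      ≈⟨ +-cong (trans (*-congʳ (+-identityʳ 1#)) (trans (*-identityˡ _) (*-identityˡ _)))
                (Σ-zero {N} (λ _ → zeroˡ _)) ⟩
    a (t ℕ.+ 0) + 0#                   ≈⟨ +-identityʳ _ ⟩
    a (t ℕ.+ 0)                        ≡⟨ cong a (ℕ.+-identityʳ t) ⟩
    a t                                ∎)
  shiftPow-binomial s a (suc f) t {suc N} (s≤s f<N) = begin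
    s * shiftPow s a f t + shiftPow s a f (suc t)
      ≈⟨ +-cong (*-congˡ (shiftPow-binomial s a f t (ℕ.m<n⇒m<1+n f<N))) (shiftPow-binomial s a f (suc t) f<N) ⟩
    s * (B f t 0 + sumBelow N (B f t ∘ suc)) + sumBelow N (B f (suc t))
      ≈⟨ +-congʳ (distribˡ s _ _) ⟩
    (s * B f t 0 + s * sumBelow N (B f t ∘ suc)) + sumBelow N (B f (suc t))
      ≈⟨ sym (x∙yz≈xz∙y _ _ _) ⟩
    s * B f t 0 + (sumBelow N (B f (suc t)) + s * sumBelow N (B f t ∘ suc))
      ≈⟨ +-cong (sym (pull-factor _ s f _)) (sym (trans (Σ-+ {N} _ _) (+-congˡ (Σ-*ˡ {N} s _)))) ⟩
    B (suc f) t 0 + sumBelow N (λ j → B f (suc t) j + s * B f t (suc j))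
      ≈⟨ +-congˡ (Σ-cong {N} (λ j → sym (pascal s a f t (toℕ j)))) ⟩
    sumBelow (suc N) (B (suc f) t) ∎
    where
    B = binomialTerm s a

module Monomials (R : CommutativeRing 0ℓ 0ℓ) where
  open CommutativeRing R hiding (zero) renaming (refl to ≈-refl)
  open InRing R
  open FiniteSums R
  open import Relation.Binary.Reasoning.Setoid setoid

  monomial : (Fin m → Carrier) → (Fin m → Bool) → Carrier
  monomial y c = Π[ (λ v → y v ^ ⟨ c v ⟩) ]

  monomial-cong : (y : Fin m → Carrier) {c c′ : Fin m → Bool} → (∀ v → c v ≡ c′ v) →
                  monomial y c ≈ monomial y c′
  monomial-cong y c≗c′ = Π-cong λ v → reflexive (cong (λ b → y v ^ ⟨ b ⟩) (c≗c′ v))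

  sparseWeight : ℕ → (Fin m → Carrier) → (Fin m → Bool) → Carrier
  sparseWeight l y c = if leqB l (count c) then 0# else monomial y c

  sparseWeight-resp : ∀ l (y : Fin m → Carrier) → Respects≗ (sparseWeight l y)
  sparseWeight-resp l y c≗c′ = if-cong (cong (leqB l) (count-cong c≗c′)) ≈-refl (monomial-cong y c≗c′)

  sparseWeight-false◂ : ∀ l (y : Fin (suc m) → Carrier) c →
                        sparseWeight l y (false ◂ c) ≈ sparseWeight l (y ∘ suc) c
  sparseWeight-false◂ l y c = if-cong {leqB l (count c)} refl ≈-refl (*-identityˡ _)

  sparseWeight-true◂ : ∀ l (y : Fin (suc m) → Carrier) c →
                       sparseWeight (suc l) y (true ◂ c) ≈ y zero * sparseWeight l (y ∘ suc) c
  sparseWeight-true◂ l y c with leqB l (count c)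
  ... | true  = sym (zeroʳ _)
  ... | false = *-congʳ (*-identityʳ _)

  ∑-sparseWeight₁ : (y : Fin m → Carrier) → ∑[ c ∈ allFuns m bits ] sparseWeight 1 y c ≈ 1#
  ∑-sparseWeight₁ {zero}  y = +-identityʳ 1#
  ∑-sparseWeight₁ {suc m} y = begin
    ∑[ c ∈ allFuns (suc m) bits ] sparseWeight 1 y c
      ≈⟨ ∑-allFuns-suc bits (sparseWeight 1 y) (sparseWeight-resp 1 y) ⟩
    ∑[ c ∈ Cs ] sparseWeight 1 y (false ◂ c) + (∑[ c ∈ Cs ] 0# + 0#)
      ≈⟨ +-cong (∑-cong Cs (sparseWeight-false◂ 1 y)) (trans (+-identityʳ _) (∑-zero Cs)) ⟩
    ∑[ c ∈ Cs ] sparseWeight 1 (y ∘ suc) c + 0#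
      ≈⟨ trans (+-identityʳ _) (∑-sparseWeight₁ (y ∘ suc)) ⟩
    1# ∎
    where Cs = allFuns m bits

  ∑-sparseWeight₂ : (y : Fin m → Carrier) → ∑[ c ∈ allFuns m bits ] sparseWeight 2 y c ≈ S y
  ∑-sparseWeight₂ {zero}  y = ≈-refl
  ∑-sparseWeight₂ {suc m} y = begin
    ∑[ c ∈ allFuns (suc m) bits ] sparseWeight 2 y c
      ≈⟨ ∑-allFuns-suc bits (sparseWeight 2 y) (sparseWeight-resp 2 y) ⟩
    ∑[ c ∈ Cs ] sparseWeight 2 y (false ◂ c) + (∑[ c ∈ Cs ] sparseWeight 2 y (true ◂ c) + 0#)
      ≈⟨ +-cong (∑-cong Cs (sparseWeight-false◂ 2 y))
                (trans (+-identityʳ _) (trans (∑-cong Cs (sparseWeight-true◂ 1 y)) (∑-*ˡ Cs (y zero) _))) ⟩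
    ∑[ c ∈ Cs ] sparseWeight 2 (y ∘ suc) c + y zero * ∑[ c ∈ Cs ] sparseWeight 1 (y ∘ suc) c
      ≈⟨ +-cong (∑-sparseWeight₂ (y ∘ suc)) (trans (*-congˡ (∑-sparseWeight₁ (y ∘ suc))) (*-identityʳ _)) ⟩
    (1# + Σ[ y ∘ suc ]) + y zero
      ≈⟨ trans (+-assoc _ _ _) (+-congˡ (+-comm _ _)) ⟩
    S y ∎
    where Cs = allFuns m bits

-- Forest sums

∸-split : ∀ {j p q} → j < p → p ≤ q → q ∸ j ≡ suc (q ∸ p) ℕ.+ (p ∸ suc j)
∸-split {zero}  {suc p} {q}     (s≤s _)   p≤q       = ≡.trans (≡.sym (ℕ.m∸n+n≡m p≤q)) (ℕ.+-suc (q ∸ suc p) p)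
∸-split {suc j} {suc p} {suc q} (s≤s j<p) (s≤s p≤q) = ∸-split j<p p≤q

module ForestSums (R : CommutativeRing 0ℓ 0ℓ) (dec : ForestDec) {p : ℕ}
                  (x : Fin p → CommutativeRing.Carrier R) where
  open CommutativeRing R hiding (zero) renaming (refl to ≈-refl)
  open InRing R
  open FiniteSums R
  open Binomial R
  open Monomials R
  open import Relation.Binary.Reasoning.Setoid setoid
  open Algebra.Properties.CommutativeSemigroup *-commutativeSemigroup using (x∙yz≈y∙xz)

  summand : (Fin k → Bool) → EdgeSet p k → Carrier
  summand r F = if admissible dec r F then weight x F else 0#

  -- r marks the W-vertices that must have degree ≥ 2; no marks gives A, all marks gives Ã.
  forestSum : (Fin k → Bool) → Carrier
  forestSum {k} r = ∑[ F ∈ allEdgeSets p k ] summand r F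

  weight-resp : {F G : EdgeSet p k} → F ≗₂ G → weight x F ≈ weight x G
  weight-resp F≗G = Π-cong λ v → reflexive (cong (x v ^_) (count-cong (F≗G v)))

  summand-resp : (r : Fin k → Bool) → Respects≗₂ (summand r)
  summand-resp r {F} {G} F≗G = if-cong
    (cong₂ (λ d b → if d then b else false) (does-forest-resp dec F≗G)
           (allB-cong λ w → cong (requirement (r w)) (count-cong λ v → F≗G v w)))
    (weight-resp F≗G) ≈-refl

  forestSum-cong : {r r′ : Fin k → Bool} → (∀ w → r w ≡ r′ w) → forestSum r ≈ forestSum r′
  forestSum-cong {k} {r} {r′} r≗r′ = ∑-cong (allEdgeSets p k) λ F → reflexive
    (cong (λ b → if (if does (dec F) then b else false) then weight x F else 0#)
          (allB-cong λ w → cong (λ b → requirement b (degW F w)) (r≗r′ w)))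

  A≈forestSum : A dec p k x ≈ forestSum (λ _ → false)
  A≈forestSum {k} =
    trans (∑-filterB _ (allEdgeSets p k) (weight x)) (∑-cong (allEdgeSets p k) forest-summand)
    where
    forest-summand : ∀ F → (if does (dec F) then weight x F else 0#) ≈ summand (λ _ → false) F
    forest-summand F with does (dec F)
    ... | true  = reflexive (cong (λ b → if b then weight x F else 0#) (≡.sym (allB-true {k})))
    ... | false = ≈-refl

  Ã≈forestSum : Ã dec p k x ≈ forestSum (λ _ → true)
  Ã≈forestSum {k} = ∑-filterB _ (allEdgeSets p k) (weight x)

  weight-insertColumn : ∀ w c (F : EdgeSet p k) → weight x (insertColumn w c F) ≈ weight x F * monomial x c
  weight-insertColumn w c F = trans (Π-cong λ v → trans
      (reflexive (cong (x v ^_) (count-insertAt (F v) w (c v))))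
      (trans (^-+ (x v) ⟨ c v ⟩ (count (F v))) (*-comm _ _)))
    (Π-* (λ v → x v ^ degV F v) (λ v → x v ^ ⟨ c v ⟩))

  module _ (r : Fin k → Bool) (w : Fin (suc k)) (c : Fin p → Bool) (F : EdgeSet p k) where

    summand-insertColumn-high : leqB 2 (count c) ≡ true →
      summand (insertAt r w false) (insertColumn w c F) ≡ summand (insertAt r w true) (insertColumn w c F)
    summand-insertColumn-high high
      rewrite Restricted-insertAt r w false c F | Restricted-insertAt r w true c F | high = refl

    summand-insertColumn-low : leqB 2 (count c) ≡ false →
      summand (insertAt r w false) (insertColumn w c F) ≈ summand r F * monomial x c
    summand-insertColumn-low low
      rewrite Restricted-insertAt r w false c F | does-forest-insertColumn dec w c {F} low
      with admissible dec r F
    ... | true  = weight-insertColumn w c F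
    ... | false = sym (zeroˡ _)

    summand-insertColumn-low-restricted : leqB 2 (count c) ≡ false →
      summand (insertAt r w true) (insertColumn w c F) ≡ 0#
    summand-insertColumn-low-restricted low
      rewrite Restricted-insertAt r w true c F | low with does (dec (insertColumn w c F))
    ... | true  = refl
    ... | false = refl

    summand-insertColumn : summand (insertAt r w false) (insertColumn w c F)
                           ≈ summand r F * sparseWeight 2 x c + summand (insertAt r w true) (insertColumn w c F)
    summand-insertColumn with leqB 2 (count c) in count≥2?
    ... | true = begin
      summand (insertAt r w false) (insertColumn w c F)
        ≡⟨ summand-insertColumn-high count≥2? ⟩
      summand (insertAt r w true) (insertColumn w c F)
        ≈⟨ sym (trans (+-congʳ (zeroʳ _)) (+-identityˡ _)) ⟩
      summand r F * 0# + summand (insertAt r w true) (insertColumn w c F) ∎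
    ... | false = begin
      summand (insertAt r w false) (insertColumn w c F)
        ≈⟨ summand-insertColumn-low count≥2? ⟩
      summand r F * monomial x c
        ≈⟨ sym (+-identityʳ _) ⟩
      summand r F * monomial x c + 0#
        ≡⟨ cong (_ +_) (≡.sym (summand-insertColumn-low-restricted count≥2?)) ⟩
      summand r F * monomial x c + summand (insertAt r w true) (insertColumn w c F) ∎

  forestSum-insertAt : (r : Fin k → Bool) (w : Fin (suc k)) →
                       forestSum (insertAt r w false) ≈ S x * forestSum r + forestSum (insertAt r w true)
  forestSum-insertAt {k} r w = begin
    forestSum (insertAt r w false)
      ≈⟨ ∑-allEdgeSets-insertColumn _ (summand-resp (insertAt r w false)) w ⟩
    ∑[ c ∈ Cs ] ∑[ F ∈ Fs ] summand (insertAt r w false) (insertColumn w c F)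
      ≈⟨ ∑-cong Cs (λ c → trans (∑-cong Fs (summand-insertColumn r w c)) (∑-+ Fs _ _)) ⟩
    ∑[ c ∈ Cs ] (∑[ F ∈ Fs ] (summand r F * sparseWeight 2 x c)
                 + ∑[ F ∈ Fs ] summand (insertAt r w true) (insertColumn w c F))
      ≈⟨ ∑-+ Cs _ _ ⟩
    ∑[ c ∈ Cs ] ∑[ F ∈ Fs ] (summand r F * sparseWeight 2 x c)
      + ∑[ c ∈ Cs ] ∑[ F ∈ Fs ] summand (insertAt r w true) (insertColumn w c F)
      ≈⟨ +-cong (∑-cong Cs λ c → ∑-*ʳ Fs (sparseWeight 2 x c) (summand r))
                (sym (∑-allEdgeSets-insertColumn _ (summand-resp (insertAt r w true)) w)) ⟩
    ∑[ c ∈ Cs ] (forestSum r * sparseWeight 2 x c) + forestSum (insertAt r w true)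
      ≈⟨ +-congʳ (trans (∑-*ˡ Cs (forestSum r) (sparseWeight 2 x))
                        (trans (*-congˡ (∑-sparseWeight₂ x)) (*-comm _ _))) ⟩
    S x * forestSum r + forestSum (insertAt r w true) ∎
    where
    Cs = allFuns p bits
    Fs = allEdgeSets p k

  ã : ℕ → Carrier
  ã t = Ã dec p t x

  forestSum-shiftPow : ∀ f (r : Fin k → Bool) → count (not ∘ r) ≡ f →
                       forestSum r ≈ shiftPow (S x) ã f (count r)
  forestSum-shiftPow {k} zero r none-free = begin
    forestSum r             ≈⟨ forestSum-cong all-restricted ⟩
    forestSum (λ _ → true)  ≈⟨ sym Ã≈forestSum ⟩
    ã k                     ≡⟨ cong ã (≡.sym (≡.trans (count-cong all-restricted) (count-const k))) ⟩
    ã (count r)             ∎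
    where
    all-restricted : ∀ w → r w ≡ true
    all-restricted w = Bool.not-injective (count≡0⇒all-false (not ∘ r) none-free w)
  forestSum-shiftPow {suc k} (suc f) r 1+f-free = begin
    forestSum r
      ≈⟨ forestSum-cong r≗ ⟩
    forestSum (insertAt r′ w false)
      ≈⟨ forestSum-insertAt r′ w ⟩
    S x * forestSum r′ + forestSum (insertAt r′ w true)
      ≈⟨ +-cong (*-congˡ (forestSum-shiftPow f r′ f-free)) (forestSum-shiftPow f (insertAt r′ w true) f-free′) ⟩
    S x * shiftPow (S x) ã f (count r′) + shiftPow (S x) ã f (count (insertAt r′ w true))
      ≡⟨ cong (λ t → S x * shiftPow (S x) ã f (count r′) + shiftPow (S x) ã f t) (count-insertAt r′ w true) ⟩
    shiftPow (S x) ã (suc f) (count r′)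
      ≡⟨ cong (shiftPow (S x) ã (suc f)) (≡.sym count-r) ⟩
    shiftPow (S x) ã (suc f) (count r) ∎
    where
    free = some-true 0 (not ∘ r) (subst (λ n → leqB 1 n ≡ true) (≡.sym 1+f-free) refl)
    w = proj₁ free
    rw≡false : r w ≡ false
    rw≡false = Bool.not-injective (proj₂ free)
    r′ = removeAt r w
    r≗ : ∀ w′ → r w′ ≡ insertAt r′ w false w′
    r≗ w′ = ≡.trans (≡.sym (insertAt-removeAt r w w′)) (cong (λ b → insertAt r′ w b w′) rw≡false)
    count-r : count r ≡ count r′
    count-r = ≡.trans (count-removeAt r w) (cong (λ b → ⟨ b ⟩ ℕ.+ count r′) rw≡false)
    f-free : count (not ∘ r′) ≡ f
    f-free = ℕ.suc-injective (≡.trans (≡.sym (count-true (not ∘ r) (proj₂ free))) 1+f-free)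
    f-free′ : count (not ∘ insertAt r′ w true) ≡ f
    f-free′ = ≡.trans (count-cong (λ w′ → ≡.sym (insertAt-map not r′ w true w′)))
                      (≡.trans (count-insertAt (not ∘ r′) w false) f-free)

  Ã-vanishes : ∀ {j} → 1 ≤ p → p ≤ j → ã j ≈ 0#
  Ã-vanishes {j} 1≤p p≤j = reflexive (cong (λ Fs → sumL (map (weight x) Fs))
    (filterB-none _ (allEdgeSets p j) (dense-admissible≡false dec 1≤p p≤j)))

  A-expansion : ∀ {q} → 1 ≤ p → p ≤ q → A dec p q x ≈ sumBelow p (binomialTerm (S x) ã q 0)
  A-expansion {q} 1≤p p≤q = begin
    A dec p q x                                   ≈⟨ A≈forestSum ⟩
    forestSum (λ _ → false)                       ≈⟨ forestSum-shiftPow q _ (count-const q) ⟩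
    shiftPow (S x) ã q (count {q} (λ _ → false))  ≡⟨ cong (shiftPow (S x) ã q) (count-false q) ⟩
    shiftPow (S x) ã q 0                          ≈⟨ shiftPow-binomial (S x) ã q 0 (ℕ.n<1+n q) ⟩
    sumBelow (suc q) (binomialTerm (S x) ã q 0)   ≈⟨ sumBelow-truncate _ (ℕ.m≤n⇒m≤1+n p≤q) tail≈0 ⟩
    sumBelow p (binomialTerm (S x) ã q 0)         ∎
    where
    tail≈0 : ∀ {j} → p ≤ j → binomialTerm (S x) ã q 0 j ≈ 0#
    tail≈0 p≤j = trans (*-congˡ (trans (*-congˡ (Ã-vanishes 1≤p p≤j)) (zeroʳ _))) (zeroʳ _)

  A-factorised : ∀ {q} → 1 ≤ p → p ≤ q →
    A dec p q x ≈ S x ^ suc (q ∸ p) * sumBelow p (λ j → fromℕ' (q C j) * (S x ^ (p ∸ suc j) * ã j))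
  A-factorised {q} 1≤p p≤q = begin
    A dec p q x                                   ≈⟨ A-expansion 1≤p p≤q ⟩
    sumBelow p (binomialTerm (S x) ã q 0)         ≈⟨ Σ-cong {p} (λ j → split-power (toℕ j) (Fin.toℕ<n j)) ⟩
    Σ[ (λ (j : Fin p) → S x ^ suc (q ∸ p) * _) ]  ≈⟨ Σ-*ˡ {p} _ _ ⟩
    S x ^ suc (q ∸ p) * sumBelow p (λ j → fromℕ' (q C j) * (S x ^ (p ∸ suc j) * ã j)) ∎
    where
    split-power : ∀ j → j < p → binomialTerm (S x) ã q 0 j
                  ≈ S x ^ suc (q ∸ p) * (fromℕ' (q C j) * (S x ^ (p ∸ suc j) * ã j))
    split-power j j<p = begin
      fromℕ' (q C j) * (S x ^ (q ∸ j) * ã j)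
        ≡⟨ cong (λ e → fromℕ' (q C j) * (S x ^ e * ã j)) (∸-split j<p p≤q) ⟩
      fromℕ' (q C j) * (S x ^ (suc (q ∸ p) ℕ.+ (p ∸ suc j)) * ã j)
        ≈⟨ *-congˡ (trans (*-congʳ (^-+ (S x) (suc (q ∸ p)) _)) (*-assoc _ _ _)) ⟩
      fromℕ' (q C j) * (S x ^ suc (q ∸ p) * (S x ^ (p ∸ suc j) * ã j))
        ≈⟨ x∙yz≈y∙xz _ _ _ ⟩
      S x ^ suc (q ∸ p) * (fromℕ' (q C j) * (S x ^ (p ∸ suc j) * ã j)) ∎

-- Poly p with the total relation is a commutative ring; evaluating the ring-generic S, Ã, Σ[_], …
-- in it at the variables builds the corresponding polynomials syntactically.
polyRing : ℕ → CommutativeRing 0ℓ 0ℓ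
polyRing p = record
  { Carrier = Poly p ; _≈_ = λ _ _ → ⊤
  ; _+_ = _⊕_ ; _*_ = _⊗_ ; -_ = ⊖_ ; 0# = 0p ; 1# = 1p }

cofactor : ForestDec → (p q : ℕ) → Poly p
cofactor dec p q =
  Σ[ (λ (j : Fin p) → fromℕ' (q C toℕ j) ⊗ ((S var ^ (p ∸ suc (toℕ j))) ⊗ Ã dec p (toℕ j) var)) ]
  where open InRing (polyRing p)

module Evaluation (R : CommutativeRing 0ℓ 0ℓ) {p : ℕ} (x : Fin p → CommutativeRing.Carrier R) where
  open CommutativeRing R hiding (zero) renaming (refl to ≈-refl)
  open InRing R
  module Syntax = InRing (polyRing p)

  ⟦Σ⟧ : (f : Fin m → Poly p) → ⟦ Syntax.Σ[ f ] ⟧ x ≈ Σ[ (λ i → ⟦ f i ⟧ x) ]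
  ⟦Σ⟧ {zero}  f = ≈-refl
  ⟦Σ⟧ {suc m} f = +-congˡ (⟦Σ⟧ (f ∘ suc))

  ⟦Π⟧ : (f : Fin m → Poly p) → ⟦ Syntax.Π[ f ] ⟧ x ≈ Π[ (λ i → ⟦ f i ⟧ x) ]
  ⟦Π⟧ {zero}  f = ≈-refl
  ⟦Π⟧ {suc m} f = *-congˡ (⟦Π⟧ (f ∘ suc))

  ⟦^⟧ : ∀ P n → ⟦ P Syntax.^ n ⟧ x ≈ ⟦ P ⟧ x ^ n
  ⟦^⟧ P zero    = ≈-refl
  ⟦^⟧ P (suc n) = *-congˡ (⟦^⟧ P n)

  ⟦fromℕ'⟧ : ∀ n → ⟦ Syntax.fromℕ' n ⟧ x ≈ fromℕ' n
  ⟦fromℕ'⟧ zero    = ≈-refl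
  ⟦fromℕ'⟧ (suc n) = +-congˡ (⟦fromℕ'⟧ n)

  ⟦sumL⟧ : {A : Set} (h : A → Poly p) (as : List A) →
           ⟦ Syntax.sumL (map h as) ⟧ x ≈ sumL (map (λ a → ⟦ h a ⟧ x) as)
  ⟦sumL⟧ h []       = ≈-refl
  ⟦sumL⟧ h (a ∷ as) = +-congˡ (⟦sumL⟧ h as)

  ⟦S⟧ : ⟦ Syntax.S var ⟧ x ≈ S x
  ⟦S⟧ = +-congˡ (⟦Σ⟧ var)

  ⟦weight⟧ : (F : EdgeSet p k) → ⟦ Syntax.weight var F ⟧ x ≈ weight x F
  ⟦weight⟧ F = trans (⟦Π⟧ (λ v → var v Syntax.^ degV F v))
                     (FiniteSums.Π-cong R λ v → ⟦^⟧ (var v) (degV F v))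

  ⟦Ã⟧ : (dec : ForestDec) → ∀ j → ⟦ Syntax.Ã dec p j var ⟧ x ≈ Ã dec p j x
  ⟦Ã⟧ dec j = trans (⟦sumL⟧ (Syntax.weight var) Fs) (FiniteSums.∑-cong R Fs ⟦weight⟧)
    where Fs = filterB (admissible dec (λ _ → true)) (allEdgeSets p j)

  ⟦cofactor⟧ : (dec : ForestDec) → ∀ q → ⟦ cofactor dec p q ⟧ x
               ≈ Binomial.sumBelow R p (λ j → fromℕ' (q C j) * (S x ^ (p ∸ suc j) * Ã dec p j x))
  ⟦cofactor⟧ dec q = trans (⟦Σ⟧ {p} _) (FiniteSums.Σ-cong R {p} λ j →
    *-cong (⟦fromℕ'⟧ (q C toℕ j))
           (*-cong (trans (⟦^⟧ (Syntax.S var) (p ∸ suc (toℕ j))) (^-cong ⟦S⟧ (p ∸ suc (toℕ j))))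
                   (⟦Ã⟧ dec (toℕ j))))
    where
    ^-cong : ∀ {u v} → u ≈ v → ∀ n → u ^ n ≈ v ^ n
    ^-cong u≈v zero    = ≈-refl
    ^-cong u≈v (suc n) = *-cong u≈v (^-cong u≈v n)

proposition3p4 : (dec : ForestDec) (p q : ℕ) → 1 ≤ p → p ≤ q →
    ((R : CommutativeRing 0ℓ 0ℓ) (x : Fin p → CommutativeRing.Carrier R) →
      CommutativeRing._≈_ R (InRing.A R dec p q x)
        (InRing.Σ[_] R (λ (j : Fin p) →
          CommutativeRing._*_ R (InRing.fromℕ' R (q C toℕ j))
            (CommutativeRing._*_ R (InRing._^_ R (InRing.S R x) (q ∸ toℕ j))
              (InRing.Ã R dec p (toℕ j) x)))))
    × ∃ (λ (Q : Poly p) → (R : CommutativeRing 0ℓ 0ℓ) (x : Fin p → CommutativeRing.Carrier R) →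
      CommutativeRing._≈_ R (InRing.A R dec p q x)
        (CommutativeRing._*_ R (InRing._^_ R (InRing.S R x) (suc (q ∸ p))) (InRing.⟦_⟧ R Q x)))
proposition3p4 dec p q 1≤p p≤q =
  (λ R x → ForestSums.A-expansion R dec x 1≤p p≤q) ,
  (cofactor dec p q , λ R x → let open CommutativeRing R in
    trans (ForestSums.A-factorised R dec x 1≤p p≤q) (*-congˡ (sym (Evaluation.⟦cofactor⟧ R x dec q))))
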